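{- Let $m\ge 2$ and let $\theta_m$ be a generalized $\theta$-graph. Then $\mu_{\mathrm{int}}(\theta_m)=2$ if $\theta_m$ is an Eulerian graph with an odd number of edges, and $\mu_{\mathrm{int}}(\theta_m)=1$ otherwise.
   Context: Graphs are finite and simple. A $k$-improper edge coloring of a graph $G$ is a map $\alpha:E(G)\to\mathbb{N}$ such that at most $k$ edges with a common endpoint receive the same color; it is an improper interval coloring if at every vertex the colors on incident edges form a set of consecutive integers. $\mu_{\mathrm{int}}(G)$ is the smallest $k$ such that $G$ has a $k$-improper interval edge coloring. A generalized $\theta$-graph $\theta_m$ ($2\le m<\infty$) is a graph consisting of two vertices $u$ and $v$ together with $m$ internally vertex-disjoint $(u,v)$-paths. -}

module Defs where

open import Data.Nat using (ℕ; zero; suc; _+_; _*_; _≤_; _<_; pred)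
open import Data.Nat.Properties using (_<?_)
open import Data.Fin using (Fin; fromℕ<; fromℕ; inject₁; toℕ)
open import Data.Product using (Σ; ∃; ∃-syntax; _×_; _,_; proj₁; proj₂)
open import Data.Sum using (_⊎_)
open import Data.Empty using (⊥)
open import Relation.Nullary using (¬_; yes; no)
open import Relation.Binary.PropositionalEquality using (_≡_)
open import Function.Definitions using (Injective; Bijective)
open import Function.Bundles using (_↔_)

-- Graphs: a vertex type, an edge type, and the two endpoints of each edge.
-- (Simplicity/finiteness of the particular graphs below is guaranteed by
-- their construction.)

record Graph : Set₁ where
  field
    V    : Set
    E    : Set
    end₁ : E → V
    end₂ : E → V

module _ (G : Graph) where
  open Graph G

  Incident : V → E → Set
  Incident x e = end₁ e ≡ x ⊎ end₂ e ≡ x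

  Joins : E → V → V → Set
  Joins e x y = (end₁ e ≡ x × end₂ e ≡ y) ⊎ (end₁ e ≡ y × end₂ e ≡ x)

  IsImproper : ℕ → (E → ℕ) → Set
  IsImproper k α = ∀ (x : V) (c : ℕ) (f : Fin (suc k) → E) →
    Injective _≡_ _≡_ f → (∀ i → Incident x (f i) × α (f i) ≡ c) → ⊥

  IsInterval : (E → ℕ) → Set
  IsInterval α = ∀ (x : V) (e₁ e₂ : E) (c : ℕ) →
    Incident x e₁ → Incident x e₂ → α e₁ ≤ c → c ≤ α e₂ →
    ∃[ e ] (Incident x e × α e ≡ c)

  HasImproperInterval : ℕ → Set
  HasImproperInterval k = ∃[ α ] (IsImproper k α × IsInterval α)

  MuIntEq : ℕ → Set
  MuIntEq k = HasImproperInterval k × (∀ j → j < k → ¬ HasImproperInterval j)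

  Eulerian : Set
  Eulerian = Σ ℕ λ n → Σ (Fin (suc n) → V) λ w → Σ (Fin n → E) λ t →
    (w Fin.zero ≡ w (fromℕ n)) × Bijective _≡_ _≡_ t ×
    (∀ i → Joins (t i) (w (inject₁ i)) (w (Fin.suc i)))
    where import Data.Fin as Fin

  Odd : ℕ → Set
  Odd n = ∃[ k ] (n ≡ suc (2 * k))

  OddEdges : Set
  OddEdges = ∃[ n ] ((E ↔ Fin n) × Odd n)

-- The generalized θ-graph with m internally disjoint (u,v)-paths of
-- lengths ℓ 0, …, ℓ (m-1).

module _ (m : ℕ) (ℓ : Fin m → ℕ) where

  data ThetaV : Set where
    u v   : ThetaV
    -- inner i j : the (j+1)-th vertex of path i (positions 1 … ℓ i - 1)
    inner : (i : Fin m) → Fin (pred (ℓ i)) → ThetaV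

  -- the vertex at position k on path i (position 0 = u, ℓ i = v)
  pos : Fin m → ℕ → ThetaV
  pos i zero = u
  pos i (suc k) with k <? pred (ℓ i)
  ... | yes p = inner i (fromℕ< p)
  ... | no _  = v

  ThetaE : Set
  ThetaE = Σ (Fin m) λ i → Fin (ℓ i)

  θ : Graph
  θ = record
    { V = ThetaV
    ; E = ThetaE
    ; end₁ = λ e → pos (proj₁ e) (toℕ (proj₂ e))
    ; end₂ = λ e → pos (proj₁ e) (suc (toℕ (proj₂ e)))
    }

-- A proper interval colouring of θ changes by exactly one along every path and uses m
-- consecutive colours at u and at v. So the end colours of a path of length ℓ differ in
-- parity by ℓ - 1, and summing over the paths, when m is even the two intervals have sums of
-- equal parity, which forces an even number of edges. As θ is Eulerian exactly when m is even
-- (walk the paths alternately forwards and backwards), an Eulerian θ with an odd number of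
-- edges needs two edges of a colour at some vertex, and colouring path i by ⌊i/2⌋ achieves this.
-- Otherwise, with e the number of even paths, colour each path by a zigzag x, x+1, x, …:
-- the even paths get 0, …, e-1 at u and the odd paths the colours above. If e is even,
-- neighbouring even paths swap their colours at v. If e and m are odd, the even paths climb
-- by one and the odd paths at odd colours climb by two, which a path of length 1 cannot do,
-- so that path is placed at an even colour. The case e odd, m even is the Eulerian one with
-- an odd number of edges.

module Submission where

open import Defs
open import Data.Nat using (ℕ; parity; ⌊_/2⌋; zero; suc; _+_; _*_; _∸_; _≤_; _<_; z≤n; s≤s; s≤s⁻¹; pred)
open import Data.Nat.Properties
open import Data.Parity.Base as ℙ using (Parity; 0ℙ; 1ℙ; _⁻¹)
open import Data.Parity.Properties as ℙₚ using (+-homo-+; *-homo-*; p+p≡0ℙ)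
open import Data.Fin using (Fin; toℕ; fromℕ<; punchOut)
open import Data.Fin.Patterns using (0F; 1F; 2F)
import Data.Fin as Fin
import Data.Fin.Properties as Finₚ
open import Data.Fin.Permutation as Perm using (Permutation)
open import Data.Product using (Σ; ∃-syntax; _×_; _,_; proj₁; proj₂)
import Data.Product
open import Data.Product.Properties using (≡-dec)
open import Data.Sum using (_⊎_; inj₁; inj₂; [_,_]′)
import Data.Sum
open import Data.Empty using (⊥-elim)
open import Relation.Nullary using (¬_; yes; no; contradiction)
open import Relation.Binary using (Tri; tri<; tri≈; tri>)
open import Relation.Binary.PropositionalEquality
open import Function using (_∘_)
open import Function.Definitions using (Injective)
open import Function.Bundles using (Inverse; Bijection; _↔_; mk↔ₛ′; mk⤖)
open import Function.Properties.Inverse using (↔-refl; ↔-sym; ↔-trans; ↔⇒⤖)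
open import Function.Properties.Bijection using (⤖⇒↔)
open import Data.Sum.Function.Propositional using (_⊎-↔_)
open import Algebra.Properties.CommutativeMonoid.Sum +-0-commutativeMonoid
  using (sum; sum-cong-≗; ∑-distrib-+; ∑-permute; sum-init-last)

private variable
  n : ℕ

-- Parity and finite sums

parity-double : ∀ k → parity (k + k) ≡ 0ℙ
parity-double k = trans (+-homo-+ k k) (p+p≡0ℙ (parity k))

parity-suc : ∀ n → parity (suc n) ≡ parity n ⁻¹
parity-suc n = +-homo-+ 1 n

parity-pred : ∀ L → 1 ≤ L → parity (pred L) ≡ parity L ⁻¹
parity-pred (suc L) _ = sym (ℙₚ.suc-homo-⁻¹ L)

parity-odd : ∀ k → parity (suc (2 * k)) ≡ 1ℙ
parity-odd k = trans (+-homo-+ 1 (2 * k)) (cong (1ℙ ℙ.+_) (*-homo-* 2 k))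

odd-witness : ∀ n → parity n ≡ 1ℙ → ∃[ k ] n ≡ suc (2 * k)
odd-witness (suc zero) _ = 0 , refl
odd-witness (suc (suc n)) p with odd-witness n p
... | k , refl = suc k , cong suc (sym (*-suc 2 k))

0ℙ-or-1ℙ : ∀ c → c ≡ 0ℙ ⊎ c ≡ 1ℙ
0ℙ-or-1ℙ 0ℙ = inj₁ refl
0ℙ-or-1ℙ 1ℙ = inj₂ refl

parity-sum-cong : (f g : Fin n → ℕ) → (∀ i → parity (f i) ≡ parity (g i)) →
  parity (sum f) ≡ parity (sum g)
parity-sum-cong {zero} f g eq = refl
parity-sum-cong {suc n} f g eq = begin
  parity (sum f)                                     ≡⟨ +-homo-+ (f Fin.zero) _ ⟩
  parity (f Fin.zero) ℙ.+ parity (sum (f ∘ Fin.suc)) ≡⟨ cong₂ ℙ._+_ (eq Fin.zero) tail-parity ⟩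
  parity (g Fin.zero) ℙ.+ parity (sum (g ∘ Fin.suc)) ≡⟨ +-homo-+ (g Fin.zero) _ ⟨
  parity (sum g)                                     ∎
  where
  open ≡-Reasoning
  tail-parity = parity-sum-cong (f ∘ Fin.suc) (g ∘ Fin.suc) (eq ∘ Fin.suc)

sum-const : ∀ n s → sum {n} (λ _ → s) ≡ n * s
sum-const zero s = refl
sum-const (suc n) s = cong (s +_) (sum-const n s)

sum-ones : ∀ n → sum {n} (λ _ → 1) ≡ n
sum-ones n = trans (sum-const n 1) (*-identityʳ n)

sum-at-zero : ∀ L → 1 ≤ L → (f : Fin L → ℕ) → (∀ j → toℕ j ≡ 0 → f j ≡ 1) →
  (∀ j → toℕ j ≢ 0 → f j ≡ 0) → sum f ≡ 1
sum-at-zero (suc L) _ f at-zero elsewhere = cong₂ _+_ (at-zero Fin.zero refl)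
  (trans (sum-cong-≗ (λ j → elsewhere (Fin.suc j) λ ())) (trans (sum-const L 0) (*-zeroʳ L)))

sum-↑ : ∀ a {b} (g : Fin (a + b) → ℕ) → sum g ≡ sum (g ∘ (Fin._↑ˡ b)) + sum (g ∘ (a Fin.↑ʳ_))
sum-↑ zero g = refl
sum-↑ (suc a) g = trans (cong (g Fin.zero +_) (sum-↑ a (g ∘ Fin.suc))) (sym (+-assoc (g Fin.zero) _ _))

half-cases : ∀ n → n ≡ ⌊ n /2⌋ + ⌊ n /2⌋ ⊎ n ≡ suc (⌊ n /2⌋ + ⌊ n /2⌋)
half-cases zero = inj₁ refl
half-cases (suc zero) = inj₂ refl
half-cases (suc (suc n)) with half-cases n
... | inj₁ eq = inj₁ (cong suc (trans (cong suc eq) (sym (+-suc _ _))))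
... | inj₂ eq = inj₂ (cong suc (trans (cong suc eq) (cong suc (sym (+-suc _ _)))))

-- Enumerating dependent pairs over Fin

Σ-Fin-suc↔ : ∀ {k} {P : Fin (suc k) → Set} →
  Σ (Fin (suc k)) P ↔ (P Fin.zero ⊎ Σ (Fin k) (P ∘ Fin.suc))
Σ-Fin-suc↔ = mk↔ₛ′
  (λ { (Fin.zero , a) → inj₁ a ; (Fin.suc i , a) → inj₂ (i , a) })
  (λ { (inj₁ a) → Fin.zero , a ; (inj₂ (i , a)) → Fin.suc i , a })
  (λ { (inj₁ _) → refl ; (inj₂ _) → refl })
  (λ { (Fin.zero , _) → refl ; (Fin.suc _ , _) → refl })

Σ-Fin↔Fin-sum : ∀ {k} (L : Fin k → ℕ) → Σ (Fin k) (Fin ∘ L) ↔ Fin (sum L)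
Σ-Fin↔Fin-sum {zero} L = mk↔ₛ′ (λ ()) (λ ()) (λ ()) (λ ())
Σ-Fin↔Fin-sum {suc k} L =
  ↔-trans Σ-Fin-suc↔ (↔-trans (↔-refl ⊎-↔ Σ-Fin↔Fin-sum (L ∘ Fin.suc)) (↔-sym Finₚ.+↔⊎))

sum-Σ-Fin : ∀ {k} (L : Fin k → ℕ) (h : Σ (Fin k) (Fin ∘ L) → ℕ) →
  sum (h ∘ Inverse.from (Σ-Fin↔Fin-sum L)) ≡ sum (λ i → sum (λ j → h (i , j)))
sum-Σ-Fin {zero} L h = refl
sum-Σ-Fin {suc k} L h = trans (sum-↑ (L Fin.zero) _) (cong₂ _+_
  (sum-cong-≗ (cong h ∘ from-↑ˡ))
  (trans (sum-cong-≗ (cong h ∘ from-↑ʳ)) (sum-Σ-Fin (L ∘ Fin.suc) (h ∘ shift))))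
  where
  from = Inverse.from (Σ-Fin↔Fin-sum L)
  shift = Data.Product.map Fin.suc (λ j → j)
  from-↑ˡ : ∀ j → from (j Fin.↑ˡ sum (L ∘ Fin.suc)) ≡ (Fin.zero , j)
  from-↑ˡ j rewrite Finₚ.splitAt-↑ˡ (L Fin.zero) j (sum (L ∘ Fin.suc)) = refl
  from-↑ʳ : ∀ y → from (L Fin.zero Fin.↑ʳ y) ≡ shift (Inverse.from (Σ-Fin↔Fin-sum (L ∘ Fin.suc)) y)
  from-↑ʳ y rewrite Finₚ.splitAt-↑ʳ (L Fin.zero) (sum (L ∘ Fin.suc)) y = refl

-- Injective maps from Fin n with an interval as image

InRange : ℕ → (Fin n → ℕ) → Set
InRange {n} s f = ∀ i → s ≤ f i × f i < s + n

Convex : (Fin n → ℕ) → Set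
Convex f = ∀ i i' c → f i ≤ c → c ≤ f i' → ∃[ i'' ] f i'' ≡ c

injective⇒surjective : {f : Fin n → Fin n} → Injective _≡_ _≡_ f → ∀ y → ∃[ x ] f x ≡ y
injective⇒surjective {suc n} {f} f-inj y with Finₚ.any? (λ x → f x Finₚ.≟ y)
... | yes hit = hit
... | no miss = contradiction (Finₚ.injective⇒≤ punched-injective) (n≮n n)
  where
  avoids : ∀ x → y ≢ f x
  avoids x eq = miss (x , sym eq)
  punched-injective : Injective _≡_ _≡_ (λ x → punchOut (avoids x))
  punched-injective eq = f-inj (Finₚ.punchOut-injective (avoids _) (avoids _) eq)

s≤x<s+n⇒x∸s<n : ∀ {s x} n → s ≤ x → x < s + n → x ∸ s < n
s≤x<s+n⇒x∸s<n {s} n s≤x x<s+n = subst (_ <_) (m+n∸m≡n s n) (∸-monoˡ-< x<s+n s≤x)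

module _ {f : Fin n → ℕ} {s : ℕ} (f-inj : Injective _≡_ _≡_ f) (range : InRange s f) where

  private
    offset : Fin n → Fin n
    offset i = fromℕ< (s≤x<s+n⇒x∸s<n n (proj₁ (range i)) (proj₂ (range i)))

    toℕ-offset : ∀ i → s + toℕ (offset i) ≡ f i
    toℕ-offset i = trans (cong (s +_) (Finₚ.toℕ-fromℕ< _)) (m+[n∸m]≡n (proj₁ (range i)))

    offset-injective : Injective _≡_ _≡_ offset
    offset-injective {i} {i'} eq =
      f-inj (trans (sym (toℕ-offset i)) (trans (cong (λ k → s + toℕ k) eq) (toℕ-offset i')))

  injective-inRange⇒convex : Convex f
  injective-inRange⇒convex i i' c fi≤c c≤fi' = hit (injective⇒surjective offset-injective k)
    where
    s≤c = ≤-trans (proj₁ (range i)) fi≤c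
    k = fromℕ< (s≤x<s+n⇒x∸s<n n s≤c (≤-<-trans c≤fi' (proj₂ (range i'))))
    hit : ∃[ x ] offset x ≡ k → ∃[ i'' ] f i'' ≡ c
    hit (i'' , eq) = i'' , (begin
      f i''                  ≡⟨ toℕ-offset i'' ⟨
      s + toℕ (offset i'')   ≡⟨ cong (λ k → s + toℕ k) eq ⟩
      s + toℕ k              ≡⟨ cong (s +_) (Finₚ.toℕ-fromℕ< _) ⟩
      s + (c ∸ s)            ≡⟨ m+[n∸m]≡n s≤c ⟩
      c                      ∎)
      where open ≡-Reasoning

  sum-inRange : sum f ≡ sum {n} (λ k → s + toℕ k)
  sum-inRange = begin
    sum f                          ≡⟨ sum-cong-≗ (λ i → sym (toℕ-offset i)) ⟩
    sum (λ i → s + toℕ (offset i)) ≡⟨ ∑-permute (λ k → s + toℕ k) shuffle ⟨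
    sum {n} (λ k → s + toℕ k)      ∎
    where
    open ≡-Reasoning
    shuffle : Permutation n n
    shuffle = mk↔ₛ′ offset (λ k → proj₁ (injective⇒surjective offset-injective k))
      (λ k → proj₂ (injective⇒surjective offset-injective k))
      (λ i → offset-injective (proj₂ (injective⇒surjective offset-injective (offset i))))

injective-≗ : {f g : Fin n → ℕ} → (∀ i → f i ≡ g i) →
  Injective _≡_ _≡_ g → Injective _≡_ _≡_ f
injective-≗ f≗g g-inj {i} {i'} eq = g-inj (trans (sym (f≗g i)) (trans eq (f≗g i')))

inRange-≗ : ∀ {s} {f g : Fin n → ℕ} → (∀ i → f i ≡ g i) → InRange s g → InRange s f
inRange-≗ f≗g range i = subst (λ c → _ ≤ c × c < _) (sym (f≗g i)) (range i)

minimum : (f : Fin (suc n) → ℕ) → ∃[ i ] ∀ j → f i ≤ f j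
minimum {zero} f = Fin.zero , λ { Fin.zero → ≤-refl }
minimum {suc n} f with minimum (f ∘ Fin.suc)
... | i , least with f Fin.zero ≤? f (Fin.suc i)
...   | yes z≤i = Fin.zero , λ { Fin.zero → ≤-refl ; (Fin.suc j) → ≤-trans z≤i (least j) }
...   | no z≰i = Fin.suc i , λ { Fin.zero → <⇒≤ (≰⇒> z≰i) ; (Fin.suc j) → least j }

injective-convex⇒inRange : {f : Fin n → ℕ} → Injective _≡_ _≡_ f → Convex f →
  ∃[ s ] InRange s f
injective-convex⇒inRange {zero} _ _ = 0 , λ ()
injective-convex⇒inRange {suc n} {f} f-inj f-convex with minimum f
... | i₀ , least = f i₀ , λ i → least i , ≰⇒> (too-large i)
  where
  too-large : ∀ i → ¬ f i₀ + suc n ≤ f i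
  too-large i big = contradiction (Finₚ.injective⇒≤ hit-injective) (n≮n (suc n))
    where
    hit : (c : Fin (suc (suc n))) → ∃[ x ] f x ≡ f i₀ + toℕ c
    hit c = f-convex i₀ i _ (m≤m+n _ _) (≤-trans (+-monoʳ-≤ (f i₀) (Finₚ.toℕ≤pred[n] c)) big)
    hit-injective : Injective _≡_ _≡_ (proj₁ ∘ hit)
    hit-injective {c} {c'} eq = Finₚ.toℕ-injective (+-cancelˡ-≡ (f i₀) _ _
      (trans (sym (proj₂ (hit c))) (trans (cong f eq) (proj₂ (hit c')))))

parity-sum-interval : {f : Fin n → ℕ} → parity n ≡ 0ℙ → Injective _≡_ _≡_ f → Convex f →
  parity (sum f) ≡ parity (sum (toℕ {n}))
parity-sum-interval {n} {f} n-even f-inj f-convex with injective-convex⇒inRange f-inj f-convex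
... | s , range = begin
  parity (sum f)                        ≡⟨ cong parity (sum-inRange f-inj range) ⟩
  parity (sum {n} (λ k → s + toℕ k))    ≡⟨ cong parity (∑-distrib-+ {n} (λ _ → s) toℕ) ⟩
  parity (ns + sum {n} toℕ)             ≡⟨ +-homo-+ ns _ ⟩
  parity ns ℙ.+ parity (sum {n} toℕ)    ≡⟨ cong (ℙ._+ parity (sum {n} toℕ)) ns-even ⟩
  parity (sum {n} toℕ)                  ∎
  where
  open ≡-Reasoning
  ns = sum {n} (λ _ → s)
  ns-even : parity ns ≡ 0ℙ
  ns-even = trans (cong parity (sum-const n s)) (trans (*-homo-* n s) (cong (ℙ._* parity s) n-even))

three-into-two : ∀ {a} (g : Fin 3 → ℕ) → Injective _≡_ _≡_ g →
  ¬ (∀ t → g t ≡ a ⊎ g t ≡ suc a)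
three-into-two g g-inj two with two 0F | two 1F | two 2F
... | inj₁ p | inj₁ q | _      = contradiction (g-inj (trans p (sym q))) λ ()
... | inj₂ p | inj₂ q | _      = contradiction (g-inj (trans p (sym q))) λ ()
... | inj₁ p | inj₂ _ | inj₁ r = contradiction (g-inj (trans p (sym r))) λ ()
... | inj₁ _ | inj₂ q | inj₂ r = contradiction (g-inj (trans q (sym r))) λ ()
... | inj₂ _ | inj₁ q | inj₁ r = contradiction (g-inj (trans q (sym r))) λ ()
... | inj₂ p | inj₁ _ | inj₂ r = contradiction (g-inj (trans p (sym r))) λ ()

-- Stable partition by a parity class

bit : Parity → ℕ
bit 0ℙ = 0
bit 1ℙ = 1

parity-bit : ∀ p → parity (bit p) ≡ p
parity-bit 0ℙ = refl
parity-bit 1ℙ = refl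

bit+bit⁻¹ : ∀ p → bit p + bit (p ⁻¹) ≡ 1
bit+bit⁻¹ 0ℙ = refl
bit+bit⁻¹ 1ℙ = refl

ones : (Fin n → Parity) → ℕ
ones p = sum (bit ∘ p)

zeros : (Fin n → Parity) → ℕ
zeros p = ones (_⁻¹ ∘ p)

onesBefore : (Fin n → Parity) → Fin n → ℕ
onesBefore p Fin.zero = 0
onesBefore p (Fin.suc i) = bit (p Fin.zero) + onesBefore (p ∘ Fin.suc) i

onesBefore<ones : (p : Fin n → Parity) (i : Fin n) → p i ≡ 1ℙ → onesBefore p i < ones p
onesBefore<ones p Fin.zero pi≡1 rewrite pi≡1 = s≤s z≤n
onesBefore<ones p (Fin.suc i) pi≡1 = +-monoʳ-< (bit (p Fin.zero)) (onesBefore<ones (p ∘ Fin.suc) i pi≡1)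

onesBefore-injective : (p : Fin n → Parity) (i i' : Fin n) → p i ≡ 1ℙ → p i' ≡ 1ℙ →
  onesBefore p i ≡ onesBefore p i' → i ≡ i'
onesBefore-injective p Fin.zero Fin.zero _ _ _ = refl
onesBefore-injective p Fin.zero (Fin.suc i') p0≡1 _ eq rewrite p0≡1 = contradiction eq 0≢1+n
onesBefore-injective p (Fin.suc i) Fin.zero _ p0≡1 eq rewrite p0≡1 = contradiction (sym eq) 0≢1+n
onesBefore-injective p (Fin.suc i) (Fin.suc i') pi≡1 pi'≡1 eq = cong Fin.suc
  (onesBefore-injective (p ∘ Fin.suc) i i' pi≡1 pi'≡1 (+-cancelˡ-≡ (bit (p Fin.zero)) _ _ eq))

ones+zeros : (p : Fin n → Parity) → ones p + zeros p ≡ n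
ones+zeros {n} p = begin
  ones p + zeros p                     ≡⟨ ∑-distrib-+ (bit ∘ p) (bit ∘ _⁻¹ ∘ p) ⟨
  sum (λ i → bit (p i) + bit (p i ⁻¹)) ≡⟨ sum-cong-≗ (bit+bit⁻¹ ∘ p) ⟩
  sum {n} (λ _ → 1)                    ≡⟨ sum-ones n ⟩
  n                                    ∎
  where open ≡-Reasoning

rank : (Fin n → Parity) → Fin n → ℕ
rank p i = place (p i)
  where
  place : Parity → ℕ
  place 0ℙ = onesBefore (_⁻¹ ∘ p) i
  place 1ℙ = zeros p + onesBefore p i

rank-0ℙ : (p : Fin n → Parity) (i : Fin n) → p i ≡ 0ℙ → rank p i ≡ onesBefore (_⁻¹ ∘ p) i
rank-0ℙ p i pi≡0 rewrite pi≡0 = refl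

rank-1ℙ : (p : Fin n → Parity) (i : Fin n) → p i ≡ 1ℙ → rank p i ≡ zeros p + onesBefore p i
rank-1ℙ p i pi≡1 rewrite pi≡1 = refl

rank<zeros : (p : Fin n → Parity) (i : Fin n) → p i ≡ 0ℙ → rank p i < zeros p
rank<zeros p i pi≡0 = subst (_< zeros p) (sym (rank-0ℙ p i pi≡0))
  (onesBefore<ones (_⁻¹ ∘ p) i (cong _⁻¹ pi≡0))

zeros≤rank : (p : Fin n → Parity) (i : Fin n) → p i ≡ 1ℙ → zeros p ≤ rank p i
zeros≤rank p i pi≡1 = subst (zeros p ≤_) (sym (rank-1ℙ p i pi≡1)) (m≤m+n _ _)

rank< : (p : Fin n → Parity) (i : Fin n) → rank p i < n
rank< {n} p i with 0ℙ-or-1ℙ (p i)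
... | inj₁ pi≡0 = <-≤-trans (rank<zeros p i pi≡0) (subst (zeros p ≤_) (ones+zeros p) (m≤n+m _ _))
... | inj₂ pi≡1 = subst (_< n) (sym (rank-1ℙ p i pi≡1))
  (subst (zeros p + onesBefore p i <_) (trans (+-comm (zeros p) _) (ones+zeros p))
    (+-monoʳ-< (zeros p) (onesBefore<ones p i pi≡1)))

rank-injective : (p : Fin n → Parity) → Injective _≡_ _≡_ (rank p)
rank-injective p {i} {i'} eq with 0ℙ-or-1ℙ (p i) | 0ℙ-or-1ℙ (p i')
... | inj₁ pi≡0 | inj₁ pi'≡0 =
  onesBefore-injective (_⁻¹ ∘ p) i i' (cong _⁻¹ pi≡0) (cong _⁻¹ pi'≡0)
  (trans (sym (rank-0ℙ p i pi≡0)) (trans eq (rank-0ℙ p i' pi'≡0)))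
... | inj₂ pi≡1 | inj₂ pi'≡1 = onesBefore-injective p i i' pi≡1 pi'≡1
  (+-cancelˡ-≡ (zeros p) _ _ (trans (sym (rank-1ℙ p i pi≡1)) (trans eq (rank-1ℙ p i' pi'≡1))))
... | inj₁ pi≡0 | inj₂ pi'≡1 =
  contradiction eq (<⇒≢ (<-≤-trans (rank<zeros p i pi≡0) (zeros≤rank p i' pi'≡1)))
... | inj₂ pi≡1 | inj₁ pi'≡0 =
  contradiction (sym eq) (<⇒≢ (<-≤-trans (rank<zeros p i' pi'≡0) (zeros≤rank p i pi≡1)))

-- Colour sequences along a path

Consecutive : ℕ → ℕ → Set
Consecutive x y = x ≡ suc y ⊎ y ≡ suc x

Consecutive-sym : ∀ {x y} → Consecutive x y → Consecutive y x
Consecutive-sym (inj₁ eq) = inj₂ eq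
Consecutive-sym (inj₂ eq) = inj₁ eq

Consecutive⇒≢ : ∀ {x y} → Consecutive x y → x ≢ y
Consecutive⇒≢ (inj₁ refl) = 1+n≢n
Consecutive⇒≢ (inj₂ refl) = 1+n≢n ∘ sym

consecutive-parity : ∀ {x y} k → Consecutive x y → parity (x + suc k) ≡ parity (y + k)
consecutive-parity {y = y} k (inj₁ refl) = cong parity (+-suc (suc y) k)
consecutive-parity {x} k (inj₂ refl) = cong parity (+-suc x k)

zig : ℕ → ℕ → ℕ
zig x zero = x
zig x (suc zero) = suc x
zig x (suc (suc k)) = zig x k

zig-step : ∀ x k → Consecutive (zig x (suc k)) (zig x k)
zig-step x zero = inj₁ refl
zig-step x (suc zero) = inj₂ refl
zig-step x (suc (suc k)) = zig-step x k

zig-even : ∀ x k → parity k ≡ 0ℙ → zig x k ≡ x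
zig-even x zero _ = refl
zig-even x (suc (suc k)) k-even = zig-even x k k-even

zig-odd : ∀ x k → parity k ≡ 1ℙ → zig x k ≡ suc x
zig-odd x (suc zero) _ = refl
zig-odd x (suc (suc k)) k-odd = zig-odd x k k-odd

record Zigzag (L x y : ℕ) : Set where
  field
    colour : ℕ → ℕ
    starts : colour 0 ≡ x
    ends : colour (pred L) ≡ y
    steps : ∀ k → Consecutive (colour (suc k)) (colour k)

zigzag-stay : ∀ {L x} → parity L ≡ 1ℙ → Zigzag L x x
zigzag-stay {suc L} {x} L-odd = record
  { colour = zig x ; starts = refl ; steps = zig-step x
  ; ends = zig-even x L (trans (parity-pred (suc L) (s≤s z≤n)) (cong _⁻¹ L-odd)) }

zigzag-up : ∀ {L x} → 1 ≤ L → parity L ≡ 0ℙ → Zigzag L x (suc x)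
zigzag-up {L} {x} L≥1 L-even = record
  { colour = zig x ; starts = refl ; steps = zig-step x
  ; ends = zig-odd x (pred L) (trans (parity-pred L L≥1) (cong _⁻¹ L-even)) }

zigzag-down : ∀ {L x} → 1 ≤ L → parity L ≡ 0ℙ → Zigzag L (suc x) x
zigzag-down {suc L} {x} _ L-even = record
  { colour = zig x ∘ suc ; starts = refl ; ends = zig-even x (suc L) L-even ; steps = zig-step x ∘ suc }

zigzag-consecutive : ∀ {L x y} → 1 ≤ L → parity L ≡ 0ℙ → Consecutive y x → Zigzag L x y
zigzag-consecutive L≥1 L-even (inj₁ refl) = zigzag-up L≥1 L-even
zigzag-consecutive L≥1 L-even (inj₂ refl) = zigzag-down L≥1 L-even

zigzag-up₂ : ∀ {L x} → parity L ≡ 1ℙ → L ≢ 1 → Zigzag L x (suc (suc x))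
zigzag-up₂ {suc zero} _ L≢1 = contradiction refl L≢1
zigzag-up₂ {suc (suc L)} {x} L-odd _ = record
  { colour = colour ; starts = refl ; ends = zig-odd (suc x) L L-odd ; steps = steps }
  where
  colour : ℕ → ℕ
  colour zero = x
  colour (suc k) = zig (suc x) k
  steps : ∀ k → Consecutive (colour (suc k)) (colour k)
  steps zero = inj₁ refl
  steps (suc k) = zig-step (suc x) k

-- Three permutations of ℕ

flipParity : ℕ → ℕ
flipParity zero = 1
flipParity (suc zero) = 0
flipParity (suc (suc x)) = suc (suc (flipParity x))

flipParity-involutive : ∀ x → flipParity (flipParity x) ≡ x
flipParity-involutive zero = refl
flipParity-involutive (suc zero) = refl
flipParity-involutive (suc (suc x)) = cong (suc ∘ suc) (flipParity-involutive x)

flipParity-injective : Injective _≡_ _≡_ flipParity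
flipParity-injective {x} {y} eq =
  trans (sym (flipParity-involutive x)) (trans (cong flipParity eq) (flipParity-involutive y))

flipParity-consecutive : ∀ x → Consecutive (flipParity x) x
flipParity-consecutive zero = inj₁ refl
flipParity-consecutive (suc zero) = inj₂ refl
flipParity-consecutive (suc (suc x)) =
  Data.Sum.map (cong (suc ∘ suc)) (cong (suc ∘ suc)) (flipParity-consecutive x)

flipParity-< : ∀ {e x} → parity e ≡ 0ℙ → x < e → flipParity x < e
flipParity-< {suc (suc e)} {zero} _ _ = s≤s (s≤s z≤n)
flipParity-< {suc (suc e)} {suc zero} _ _ = s≤s z≤n
flipParity-< {suc (suc e)} {suc (suc x)} e-even (s≤s (s≤s x<e)) = s≤s (s≤s (flipParity-< e-even x<e))

liftOdd : ℕ → ℕ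
liftOdd zero = zero
liftOdd (suc zero) = 3
liftOdd (suc (suc x)) = suc (suc (liftOdd x))

liftOdd-even : ∀ x → parity x ≡ 0ℙ → liftOdd x ≡ x
liftOdd-even zero _ = refl
liftOdd-even (suc (suc x)) x-even = cong (suc ∘ suc) (liftOdd-even x x-even)

liftOdd-odd : ∀ x → parity x ≡ 1ℙ → liftOdd x ≡ suc (suc x)
liftOdd-odd (suc zero) _ = refl
liftOdd-odd (suc (suc x)) x-odd = cong (suc ∘ suc) (liftOdd-odd x x-odd)

parity-liftOdd : ∀ x → parity (liftOdd x) ≡ parity x
parity-liftOdd zero = refl
parity-liftOdd (suc zero) = refl
parity-liftOdd (suc (suc x)) = parity-liftOdd x

liftOdd-injective : Injective _≡_ _≡_ liftOdd
liftOdd-injective {x} {y} eq with 0ℙ-or-1ℙ (parity x) | 0ℙ-or-1ℙ (parity y)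
... | inj₁ x-even | inj₁ y-even = trans (sym (liftOdd-even x x-even)) (trans eq (liftOdd-even y y-even))
... | inj₂ x-odd | inj₂ y-odd = suc-injective (suc-injective
  (trans (sym (liftOdd-odd x x-odd)) (trans eq (liftOdd-odd y y-odd))))
... | inj₁ x-even | inj₂ y-odd = contradiction (trans (sym x-even) (trans (sym (parity-liftOdd x))
  (trans (cong parity eq) (trans (parity-liftOdd y) y-odd)))) λ ()
... | inj₂ x-odd | inj₁ y-even = contradiction (trans (sym y-even) (trans (sym (parity-liftOdd y))
  (trans (cong parity (sym eq)) (trans (parity-liftOdd x) x-odd)))) λ ()

liftOdd-≤ : ∀ {m x} → parity m ≡ 1ℙ → x < m → liftOdd x ≤ m
liftOdd-≤ {x = zero} _ _ = z≤n
liftOdd-≤ {suc zero} {suc zero} _ (s≤s ())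
liftOdd-≤ {suc (suc (suc m))} {suc zero} _ _ = s≤s (s≤s (s≤s z≤n))
liftOdd-≤ {suc (suc m)} {suc (suc x)} m-odd (s≤s (s≤s x<m)) = s≤s (s≤s (liftOdd-≤ m-odd x<m))

liftOdd-> : ∀ {e x} → parity e ≡ 1ℙ → e ≤ x → e < liftOdd x
liftOdd-> {e} {x} e-odd e≤x with 0ℙ-or-1ℙ (parity x)
... | inj₁ x-even = subst (e <_) (sym (liftOdd-even x x-even))
  (≤∧≢⇒< e≤x λ { refl → contradiction (trans (sym e-odd) x-even) λ () })
... | inj₂ x-odd = subst (e <_) (sym (liftOdd-odd x x-odd)) (s≤s (≤-trans e≤x (n≤1+n x)))

swapSuc : ℕ → ℕ → ℕ
swapSuc zero zero = 1
swapSuc zero (suc zero) = 0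
swapSuc zero (suc (suc x)) = suc (suc x)
swapSuc (suc r) zero = zero
swapSuc (suc r) (suc x) = suc (swapSuc r x)

swapSuc-involutive : ∀ r x → swapSuc r (swapSuc r x) ≡ x
swapSuc-involutive zero zero = refl
swapSuc-involutive zero (suc zero) = refl
swapSuc-involutive zero (suc (suc x)) = refl
swapSuc-involutive (suc r) zero = refl
swapSuc-involutive (suc r) (suc x) = cong suc (swapSuc-involutive r x)

swapSuc-at : ∀ r → swapSuc r r ≡ suc r
swapSuc-at zero = refl
swapSuc-at (suc r) = cong suc (swapSuc-at r)

swapSuc-below : ∀ {r x} → x < r → swapSuc r x ≡ x
swapSuc-below {suc r} {zero} _ = refl
swapSuc-below {suc r} {suc x} (s≤s x<r) = cong suc (swapSuc-below x<r)

swapSuc-≥ : ∀ {e r x} → e ≤ r → e ≤ x → e ≤ swapSuc r x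
swapSuc-≥ {zero} _ _ = z≤n
swapSuc-≥ {suc e} {suc r} {suc x} (s≤s e≤r) (s≤s e≤x) = s≤s (swapSuc-≥ e≤r e≤x)

swapSuc-< : ∀ {m r x} → suc r < m → x < m → swapSuc r x < m
swapSuc-< {suc zero} {zero} {zero} (s≤s ()) _
swapSuc-< {suc (suc m)} {zero} {zero} _ _ = s≤s (s≤s z≤n)
swapSuc-< {suc m} {zero} {suc zero} _ _ = s≤s z≤n
swapSuc-< {m} {zero} {suc (suc x)} _ x<m = x<m
swapSuc-< {suc m} {suc r} {zero} _ _ = s≤s z≤n
swapSuc-< {suc m} {suc r} {suc x} (s≤s r<m) (s≤s x<m) = s≤s (swapSuc-< r<m x<m)

-- Trails

suc[n∸[1+k]]≡n∸k : ∀ {n k} → k < n → suc (n ∸ suc k) ≡ n ∸ k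
suc[n∸[1+k]]≡n∸k {suc n} {zero} _ = refl
suc[n∸[1+k]]≡n∸k {suc n} {suc k} (s≤s k<n) = suc[n∸[1+k]]≡n∸k k<n

module Trails (G : Graph) where
  open Graph G

  -- The k-th edge traversed is ι (to edge k), so the trail uses each element of X exactly once.
  record Trail {X : Set} (ι : X → E) (x y : V) : Set where
    field
      length : ℕ
      vertex : ℕ → V
      edge : Fin length ↔ X
      starts : vertex 0 ≡ x
      ends : vertex length ≡ y
      joins : ∀ k → Joins G (ι (Inverse.to edge k)) (vertex (toℕ k)) (vertex (suc (toℕ k)))

  Joins-resp : ∀ {e x y x' y'} → x ≡ x' → y ≡ y' → Joins G e x y → Joins G e x' y'
  Joins-resp refl refl joins = joins

  empty : ∀ {X} {ι : X → E} {x} → ¬ X → Trail ι x x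
  empty {x = x} none = record
    { length = 0 ; vertex = λ _ → x ; edge = mk↔ₛ′ (λ ()) (⊥-elim ∘ none) (⊥-elim ∘ none) (λ ())
    ; starts = refl ; ends = refl ; joins = λ () }

  reverse : ∀ {X} {ι : X → E} {x y} → Trail ι x y → Trail ι y x
  reverse T = record
    { length = length
    ; vertex = λ k → vertex (length ∸ k)
    ; edge = ↔-trans Perm.reverse edge
    ; starts = ends
    ; ends = trans (cong vertex (n∸n≡0 length)) starts
    ; joins = λ k → Joins-resp (cong vertex (after k)) (cong vertex (Finₚ.opposite-prop k))
        (Data.Sum.swap (joins (Fin.opposite k)))
    }
    where
    open Trail T
    after : ∀ k → suc (toℕ (Fin.opposite k)) ≡ length ∸ toℕ k
    after k = trans (cong suc (Finₚ.opposite-prop k)) (suc[n∸[1+k]]≡n∸k (Finₚ.toℕ<n k))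

  _++_ : ∀ {X Y} {ι : X → E} {κ : Y → E} {x y z} →
    Trail ι x y → Trail κ y z → Trail [ ι , κ ]′ x z
  _++_ {ι = ι} {κ} T U = record
    { length = n₁ + n₂
    ; vertex = vertex
    ; edge = edge
    ; starts = trans (vertex-left z≤n) T.starts
    ; ends = trans (vertex-right n₂) U.ends
    ; joins = λ k → subst JoinsAt (Finₚ.join-splitAt n₁ n₂ k) (joins-split (Fin.splitAt n₁ k))
    }
    where
    module T = Trail T
    module U = Trail U
    n₁ = T.length
    n₂ = U.length
    edge : Fin (n₁ + n₂) ↔ _
    edge = ↔-trans Finₚ.+↔⊎ (T.edge ⊎-↔ U.edge)
    vertex : ℕ → V
    vertex k with k ≤? n₁
    ... | yes _ = T.vertex k
    ... | no _ = U.vertex (k ∸ n₁)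
    vertex-left : ∀ {k} → k ≤ n₁ → vertex k ≡ T.vertex k
    vertex-left {k} k≤ with k ≤? n₁
    ... | yes _ = refl
    ... | no k≰ = contradiction k≤ k≰
    vertex-right : ∀ k → vertex (n₁ + k) ≡ U.vertex k
    vertex-right k with n₁ + k ≤? n₁
    ... | no _ = cong U.vertex (m+n∸m≡n n₁ k)
    ... | yes ≤n₁ with n≤0⇒n≡0 (+-cancelˡ-≤ n₁ k 0 (≤-trans ≤n₁ (≤-reflexive (sym (+-identityʳ n₁)))))
    ...   | refl = trans (cong T.vertex (+-identityʳ n₁)) (trans T.ends (sym U.starts))
    JoinsAt : Fin (n₁ + n₂) → Set
    JoinsAt k = Joins G ([ ι , κ ]′ (Inverse.to edge k)) (vertex (toℕ k)) (vertex (suc (toℕ k)))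
    joins-split : ∀ s → JoinsAt (Fin.join n₁ n₂ s)
    joins-split (inj₁ j) rewrite Finₚ.splitAt-↑ˡ n₁ j n₂ = Joins-resp
      (sym (trans (cong vertex (Finₚ.toℕ-↑ˡ j n₂)) (vertex-left (<⇒≤ (Finₚ.toℕ<n j)))))
      (sym (trans (cong (vertex ∘ suc) (Finₚ.toℕ-↑ˡ j n₂)) (vertex-left (Finₚ.toℕ<n j))))
      (T.joins j)
    joins-split (inj₂ j) rewrite Finₚ.splitAt-↑ʳ n₁ n₂ j = Joins-resp
      (sym (trans (cong vertex (Finₚ.toℕ-↑ʳ n₁ j)) (vertex-right (toℕ j))))
      (sym (trans (cong vertex (trans (cong suc (Finₚ.toℕ-↑ʳ n₁ j)) (sym (+-suc n₁ (toℕ j)))))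
        (vertex-right (suc (toℕ j)))))
      (U.joins j)

  reindex : ∀ {X Y} {ι : X → E} {κ : Y → E} {x y} (φ : X ↔ Y) →
    (∀ a → κ (Inverse.to φ a) ≡ ι a) → Trail ι x y → Trail κ x y
  reindex φ κφ≡ι T = record
    { length = length ; vertex = vertex ; edge = ↔-trans edge φ ; starts = starts ; ends = ends
    ; joins = λ k → subst (λ e → Joins G e _ _) (sym (κφ≡ι _)) (joins k) }
    where open Trail T

  -- Traverse the trails alternately forwards and backwards; after an even number we are back at x.
  circuit : ∀ k {P : Fin k → Set} {ι : ∀ i → P i → E} {x y} → parity k ≡ 0ℙ →
    (∀ i → Trail (ι i) x y) → Trail (λ (p : Σ (Fin k) P) → ι (proj₁ p) (proj₂ p)) x x
  circuit zero _ _ = empty λ { (() , _) }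
  circuit (suc (suc k)) k-even T = reindex (↔-sym (↔-trans Σ-Fin-suc↔ (↔-refl ⊎-↔ Σ-Fin-suc↔)))
    (λ { (inj₁ _) → refl ; (inj₂ (inj₁ _)) → refl ; (inj₂ (inj₂ _)) → refl })
    (T 0F ++ (reverse (T 1F) ++ circuit k k-even (T ∘ Fin.suc ∘ Fin.suc)))

-- The θ-graph

firstOf : ∀ L → 1 ≤ L → Fin L
firstOf (suc L) _ = Fin.zero

lastOf : ∀ L → 1 ≤ L → Fin L
lastOf (suc L) _ = Fin.fromℕ L

toℕ-firstOf : ∀ L (L≥1 : 1 ≤ L) → toℕ (firstOf L L≥1) ≡ 0
toℕ-firstOf (suc L) _ = refl

suc-toℕ-lastOf : ∀ L (L≥1 : 1 ≤ L) → suc (toℕ (lastOf L L≥1)) ≡ L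
suc-toℕ-lastOf (suc L) _ = cong suc (Finₚ.toℕ-fromℕ L)

module Theta (m : ℕ) (ℓ : Fin m → ℕ) (nonempty : ∀ i → 1 ≤ ℓ i) where

  V = ThetaV m ℓ
  E = ThetaE m ℓ
  G = θ m ℓ

  at : Fin m → ℕ → V
  at = pos m ℓ

  suc-pred-ℓ : ∀ i → suc (pred (ℓ i)) ≡ ℓ i
  suc-pred-ℓ i with ℓ i | nonempty i
  ... | suc _ | _ = refl

  at≡u : ∀ i p → at i p ≡ u → p ≡ 0
  at≡u i zero _ = refl
  at≡u i (suc p) eq with p <? pred (ℓ i)
  at≡u i (suc p) () | yes _
  at≡u i (suc p) () | no _

  at≡v : ∀ i p → at i p ≡ v → ℓ i ≤ p
  at≡v i (suc p) eq with p <? pred (ℓ i)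
  at≡v i (suc p) () | yes _
  ... | no p≮ = ≤-trans (≤-reflexive (sym (suc-pred-ℓ i))) (s≤s (≮⇒≥ p≮))

  at≡inner : ∀ i p i' k → at i p ≡ inner i' k → i ≡ i' × p ≡ suc (toℕ k)
  at≡inner i (suc p) i' k eq with p <? pred (ℓ i)
  at≡inner i (suc p) i' k () | no _
  at≡inner i (suc p) .i .(fromℕ< lt) refl | yes lt = refl , cong suc (sym (Finₚ.toℕ-fromℕ< lt))

  at-ℓ : ∀ i → at i (ℓ i) ≡ v
  at-ℓ i = subst (λ p → at i p ≡ v) (suc-pred-ℓ i) (beyond (pred (ℓ i)) ≤-refl)
    where
    beyond : ∀ p → pred (ℓ i) ≤ p → at i (suc p) ≡ v
    beyond p ≤p with p <? pred (ℓ i)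
    ... | yes p< = contradiction ≤p (<⇒≱ p<)
    ... | no _ = refl

  at-interior : ∀ i p → suc p < ℓ i → ∃[ k ] at i (suc p) ≡ inner i k × toℕ k ≡ p
  at-interior i p <ℓ with p <? pred (ℓ i)
  ... | yes p< = fromℕ< p< , refl , Finₚ.toℕ-fromℕ< p<
  ... | no p≮ = contradiction (s≤s⁻¹ (subst (suc p <_) (sym (suc-pred-ℓ i)) <ℓ)) p≮

  incident-inner : ∀ {i' k i j} → Incident G (inner i' k) (i , j) →
    i ≡ i' × (toℕ j ≡ toℕ k ⊎ toℕ j ≡ suc (toℕ k))
  incident-inner {i'} {k} {i} {j} (inj₁ eq) with at≡inner i (toℕ j) i' k eq
  ... | i≡i' , j≡ = i≡i' , inj₂ j≡
  incident-inner {i'} {k} {i} {j} (inj₂ eq) with at≡inner i (suc (toℕ j)) i' k eq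
  ... | i≡i' , j≡ = i≡i' , inj₁ (suc-injective j≡)

  edge-≡ : ∀ {e e' : E} → proj₁ e ≡ proj₁ e' → toℕ (proj₂ e) ≡ toℕ (proj₂ e') → e ≡ e'
  edge-≡ {i , _} refl eq = cong (i ,_) (Finₚ.toℕ-injective eq)

  first : ∀ i → Fin (ℓ i)
  first i = firstOf (ℓ i) (nonempty i)

  last : ∀ i → Fin (ℓ i)
  last i = lastOf (ℓ i) (nonempty i)

  record BranchVertex (x : V) (end : ∀ i → Fin (ℓ i)) : Set where
    field
      incident⇒end : ∀ {i j} → Incident G x (i , j) → j ≡ end i
      end-incident : ∀ i → Incident G x (i , end i)

  u-branch : BranchVertex u first
  u-branch = record
    { incident⇒end = incident⇒first
    ; end-incident = λ i → inj₁ (cong (at i) (toℕ-firstOf (ℓ i) (nonempty i)))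
    }
    where
    incident⇒first : ∀ {i j} → Incident G u (i , j) → j ≡ first i
    incident⇒first {i} {j} (inj₁ eq) =
      Finₚ.toℕ-injective (trans (at≡u i _ eq) (sym (toℕ-firstOf (ℓ i) (nonempty i))))
    incident⇒first {i} {j} (inj₂ eq) = contradiction (at≡u i _ eq) 1+n≢0

  v-branch : BranchVertex v last
  v-branch = record
    { incident⇒end = incident⇒last
    ; end-incident = λ i → inj₂ (trans (cong (at i) (suc-toℕ-lastOf (ℓ i) (nonempty i))) (at-ℓ i))
    }
    where
    incident⇒last : ∀ {i j} → Incident G v (i , j) → j ≡ last i
    incident⇒last {i} {j} (inj₁ eq) = contradiction (at≡v i _ eq) (<⇒≱ (Finₚ.toℕ<n j))
    incident⇒last {i} {j} (inj₂ eq) = Finₚ.toℕ-injective (suc-injective (trans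
      (≤-antisym (Finₚ.toℕ<n j) (at≡v i _ eq)) (sym (suc-toℕ-lastOf (ℓ i) (nonempty i)))))

  junction-edges : ∀ {i} (j j' : Fin (ℓ i)) → toℕ j' ≡ suc (toℕ j) →
    ∀ {e} → Incident G (at i (suc (toℕ j))) e → e ≡ (i , j) ⊎ e ≡ (i , j')
  junction-edges {i} j j' j'≡ {i₂ , j₂} inc
    with at-interior i (toℕ j) (subst (_< ℓ i) j'≡ (Finₚ.toℕ<n j'))
  ... | k , at≡ , k≡ with incident-inner (subst (λ x → Incident G x (i₂ , j₂)) at≡ inc)
  ... | refl , inj₁ j₂≡ = inj₁ (edge-≡ refl (trans j₂≡ k≡))
  ... | refl , inj₂ j₂≡ = inj₂ (edge-≡ refl (trans j₂≡ (trans (cong suc k≡) (sym j'≡))))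

  -- Proper interval colourings of θ

  DistinctAt : (E → ℕ) → V → Set
  DistinctAt α x = ∀ {e e'} → Incident G x e → Incident G x e' → α e ≡ α e' → e ≡ e'

  IntervalAt : (E → ℕ) → V → Set
  IntervalAt α x = ∀ e₁ e₂ c → Incident G x e₁ → Incident G x e₂ → α e₁ ≤ c → c ≤ α e₂ →
    ∃[ e ] (Incident G x e × α e ≡ c)

  distinct⇒1-improper : ∀ {α} → (∀ x → DistinctAt α x) → IsImproper G 1 α
  distinct⇒1-improper distinct x c f f-inj at-x = 0≢1 (f-inj (distinct x (proj₁ (at-x _)) (proj₁ (at-x _))
    (trans (proj₂ (at-x Fin.zero)) (sym (proj₂ (at-x (Fin.suc Fin.zero)))))))
    where
    0≢1 : Fin.zero ≢ Fin.suc Fin.zero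
    0≢1 ()

  1-improper⇒distinct : ∀ {α} → IsImproper G 1 α → ∀ x → DistinctAt α x
  1-improper⇒distinct {α} improper x {e} {e'} inc inc' same with ≡-dec Finₚ._≟_ Finₚ._≟_ e e'
  ... | yes e≡e' = e≡e'
  ... | no e≢e' = ⊥-elim (improper x (α e) pair pair-injective pair-at-x)
    where
    pair : Fin 2 → E
    pair Fin.zero = e
    pair (Fin.suc _) = e'
    pair-injective : Injective _≡_ _≡_ pair
    pair-injective {Fin.zero} {Fin.zero} _ = refl
    pair-injective {Fin.zero} {Fin.suc Fin.zero} eq = contradiction eq e≢e'
    pair-injective {Fin.suc Fin.zero} {Fin.zero} eq = contradiction (sym eq) e≢e'
    pair-injective {Fin.suc Fin.zero} {Fin.suc Fin.zero} _ = refl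
    pair-at-x : ∀ t → Incident G x (pair t) × α (pair t) ≡ α e
    pair-at-x Fin.zero = inc , refl
    pair-at-x (Fin.suc _) = inc' , sym same

  StepsByOne : (E → ℕ) → Set
  StepsByOne α = ∀ i (j j' : Fin (ℓ i)) → toℕ j' ≡ suc (toℕ j) →
    Consecutive (α (i , j')) (α (i , j))

  inner-edges : ∀ {α i' k e e'} → StepsByOne α →
    Incident G (inner i' k) e → Incident G (inner i' k) e' → e ≡ e' ⊎ Consecutive (α e) (α e')
  inner-edges {e = i , j} {i₂ , j₂} steps inc inc' with incident-inner inc | incident-inner inc'
  ... | refl , inj₁ j≡ | refl , inj₁ j₂≡ = inj₁ (edge-≡ refl (trans j≡ (sym j₂≡)))
  ... | refl , inj₂ j≡ | refl , inj₂ j₂≡ = inj₁ (edge-≡ refl (trans j≡ (sym j₂≡)))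
  ... | refl , inj₁ j≡ | refl , inj₂ j₂≡ =
    inj₂ (Consecutive-sym (steps i j j₂ (trans j₂≡ (cong suc (sym j≡)))))
  ... | refl , inj₂ j≡ | refl , inj₁ j₂≡ = inj₂ (steps i j₂ j (trans j≡ (cong suc (sym j₂≡))))

  record ProperIntervalShape (α : E → ℕ) : Set where
    field
      steps : StepsByOne α
      first-injective : Injective _≡_ _≡_ (λ i → α (i , first i))
      first-convex : Convex (λ i → α (i , first i))
      last-injective : Injective _≡_ _≡_ (λ i → α (i , last i))
      last-convex : Convex (λ i → α (i , last i))

  module _ {x end} (branch : BranchVertex x end) {α : E → ℕ} where
    open BranchVertex branch

    branch-distinct : Injective _≡_ _≡_ (λ i → α (i , end i)) → DistinctAt α x
    branch-distinct inj inc inc' same with incident⇒end inc | incident⇒end inc'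
    ... | refl | refl with inj same
    ... | refl = refl

    branch-interval : Convex (λ i → α (i , end i)) → IntervalAt α x
    branch-interval convex (i , _) (i' , _) c inc inc' ≤c c≤
      with incident⇒end inc | incident⇒end inc'
    ... | refl | refl with convex i i' c ≤c c≤
    ... | i'' , colour≡ = (i'' , end i'') , end-incident i'' , colour≡

    branch-injective : DistinctAt α x → Injective _≡_ _≡_ (λ i → α (i , end i))
    branch-injective distinct same = cong proj₁ (distinct (end-incident _) (end-incident _) same)

    branch-convex : IntervalAt α x → Convex (λ i → α (i , end i))
    branch-convex interval i i' c ≤c c≤
      with interval (i , end i) (i' , end i') c (end-incident i) (end-incident i') ≤c c≤
    ... | (i'' , j) , inc , colour≡ with incident⇒end inc
    ... | refl = i'' , colour≡

  inner-distinct : ∀ {α i' k} → StepsByOne α → DistinctAt α (inner i' k)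
  inner-distinct steps inc inc' same with inner-edges steps inc inc'
  ... | inj₁ e≡e' = e≡e'
  ... | inj₂ consecutive = contradiction same (Consecutive⇒≢ consecutive)

  inner-interval : ∀ {α i' k} → StepsByOne α → IntervalAt α (inner i' k)
  inner-interval {α} steps e₁ e₂ c inc₁ inc₂ ≤c c≤ with inner-edges steps inc₁ inc₂
  ... | inj₁ refl = e₁ , inc₁ , ≤-antisym ≤c c≤
  ... | inj₂ (inj₁ α₁≡) = contradiction (≤-trans ≤c c≤) (<⇒≱ (≤-reflexive (sym α₁≡)))
  ... | inj₂ (inj₂ α₂≡) with m≤n⇒m<n∨m≡n ≤c
  ...   | inj₂ α₁≡c = e₁ , inc₁ , α₁≡c
  ...   | inj₁ α₁<c = e₂ , inc₂ , ≤-antisym (subst (_≤ c) (sym α₂≡) α₁<c) c≤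

  shape⇒proper-interval : ∀ {α} → ProperIntervalShape α → IsImproper G 1 α × IsInterval G α
  shape⇒proper-interval {α} shape = distinct⇒1-improper distinct , interval
    where
    open ProperIntervalShape shape
    distinct : ∀ x → DistinctAt α x
    distinct u = branch-distinct u-branch first-injective
    distinct v = branch-distinct v-branch last-injective
    distinct (inner _ _) = inner-distinct steps
    interval : ∀ x → IntervalAt α x
    interval u = branch-interval u-branch first-convex
    interval v = branch-interval v-branch last-convex
    interval (inner _ _) = inner-interval steps

  gap-free : ∀ {p q} → p < q → suc p ≡ p ⊎ suc p ≡ q → q ≡ suc p
  gap-free _ (inj₁ eq) = contradiction eq 1+n≢n
  gap-free _ (inj₂ eq) = sym eq

  steps-by-one : ∀ {α} → (∀ x → DistinctAt α x) → (∀ x → IntervalAt α x) → StepsByOne α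
  steps-by-one {α} distinct interval i j j' j'≡ = compare (<-cmp (α (i , j)) (α (i , j')))
    where
    x = at i (suc (toℕ j))
    inc : Incident G x (i , j)
    inc = inj₂ refl
    inc' : Incident G x (i , j')
    inc' = inj₁ (cong (at i) j'≡)
    colour-at-junction : ∀ {e c} → Incident G x e → α e ≡ c → c ≡ α (i , j) ⊎ c ≡ α (i , j')
    colour-at-junction inc'' refl = Data.Sum.map (cong α) (cong α) (junction-edges j j' j'≡ inc'')
    compare : Tri _ _ _ → Consecutive (α (i , j')) (α (i , j))
    compare (tri≈ _ same _) = contradiction (cong (toℕ ∘ proj₂) (distinct x inc inc' same))
      (1+n≢n ∘ trans (sym j'≡) ∘ sym)
    compare (tri< p<q _ _) with interval x (i , j) (i , j') _ inc inc' (n≤1+n _) p<q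
    ... | _ , inc'' , colour≡ = inj₁ (gap-free p<q (colour-at-junction inc'' colour≡))
    compare (tri> _ _ q<p) with interval x (i , j') (i , j) _ inc' inc (n≤1+n _) q<p
    ... | _ , inc'' , colour≡ = inj₂ (gap-free q<p (Data.Sum.swap (colour-at-junction inc'' colour≡)))

  proper-interval⇒shape : ∀ {α} → IsImproper G 1 α → IsInterval G α → ProperIntervalShape α
  proper-interval⇒shape improper interval = record
    { steps = steps-by-one distinct interval
    ; first-injective = branch-injective u-branch (distinct u)
    ; first-convex = branch-convex u-branch (interval u)
    ; last-injective = branch-injective v-branch (distinct v)
    ; last-convex = branch-convex v-branch (interval v)
    }
    where
    distinct = 1-improper⇒distinct improper

  -- The parity obstruction

  path-parity : ∀ {α} → StepsByOne α → ∀ i (j : Fin (ℓ i)) →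
    parity (α (i , j) + toℕ j) ≡ parity (α (i , first i))
  path-parity {α} steps i j = go (toℕ j) j refl
    where
    go : ∀ k (j : Fin (ℓ i)) → toℕ j ≡ k → parity (α (i , j) + k) ≡ parity (α (i , first i))
    go zero j j≡0 = cong parity (trans (+-identityʳ _) (cong (λ j → α (i , j))
      (Finₚ.toℕ-injective (trans j≡0 (sym (toℕ-firstOf (ℓ i) (nonempty i)))))))
    go (suc k) j j≡ =
      trans (consecutive-parity k (steps i j' j (trans j≡ (cong suc (sym toℕ-j'))))) (go k j' toℕ-j')
      where
      k<ℓ : k < ℓ i
      k<ℓ = <-trans (n<1+n k) (subst (_< ℓ i) j≡ (Finₚ.toℕ<n j))
      j' = fromℕ< k<ℓ
      toℕ-j' = Finₚ.toℕ-fromℕ< k<ℓ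

  end-parity : ∀ {α} → StepsByOne α → ∀ i →
    parity (α (i , last i) + ℓ i) ≡ parity (1 + α (i , first i))
  end-parity {α} steps i = begin
    parity (B + ℓ i)                 ≡⟨ cong (λ L → parity (B + L)) (suc-toℕ-lastOf (ℓ i) (nonempty i)) ⟨
    parity (B + suc (toℕ (last i)))  ≡⟨ cong parity (+-suc B _) ⟩
    parity (1 + (B + toℕ (last i)))  ≡⟨ +-homo-+ 1 (B + toℕ (last i)) ⟩
    1ℙ ℙ.+ parity (B + toℕ (last i)) ≡⟨ cong (1ℙ ℙ.+_) (path-parity steps i (last i)) ⟩
    1ℙ ℙ.+ parity A                  ≡⟨ +-homo-+ 1 A ⟨
    parity (1 + A)                   ∎
    where
    open ≡-Reasoning
    A = α (i , first i)
    B = α (i , last i)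

  proper-interval⇒even-edges : ∀ {α} → IsImproper G 1 α → IsInterval G α →
    parity m ≡ 0ℙ → parity (sum ℓ) ≡ 0ℙ
  proper-interval⇒even-edges {α} improper interval m-even = ℙₚ.+-cancelˡ-≡ (parity (sum B)) _ _ (begin
    parity (sum B) ℙ.+ parity (sum ℓ)  ≡⟨ +-homo-+ (sum B) _ ⟨
    parity (sum B + sum ℓ)             ≡⟨ cong parity (∑-distrib-+ B ℓ) ⟨
    parity (sum (λ i → B i + ℓ i))     ≡⟨ parity-sum-cong _ _ (end-parity steps) ⟩
    parity (sum (λ i → 1 + A i))       ≡⟨ cong parity (∑-distrib-+ (λ _ → 1) A) ⟩
    parity (sum {m} (λ _ → 1) + sum A) ≡⟨ cong (λ k → parity (k + sum A)) (sum-ones m) ⟩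
    parity (m + sum A)                 ≡⟨ +-homo-+ m _ ⟩
    parity m ℙ.+ parity (sum A)        ≡⟨ cong₂ ℙ._+_ m-even (trans A-parity (sym B-parity)) ⟩
    parity (sum B)                     ≡⟨ ℙₚ.+-identityʳ _ ⟨
    parity (sum B) ℙ.+ 0ℙ              ∎)
    where
    open ≡-Reasoning
    open ProperIntervalShape (proper-interval⇒shape improper interval)
    A B : Fin m → ℕ
    A i = α (i , first i)
    B i = α (i , last i)
    A-parity = parity-sum-interval m-even first-injective first-convex
    B-parity = parity-sum-interval m-even last-injective last-convex

  -- A 2-improper interval colouring

  halfIndex : E → ℕ
  halfIndex (i , _) = ⌊ toℕ i /2⌋

  module _ {x end} (branch : BranchVertex x end) where
    open BranchVertex branch

    branch-edge : ∀ {e} → Incident G x e → e ≡ (proj₁ e , end (proj₁ e))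
    branch-edge inc = cong (_ ,_) (incident⇒end inc)

    halfIndex-2-improper-at-branch : ∀ c (f : Fin 3 → E) → Injective _≡_ _≡_ f →
      ¬ (∀ t → Incident G x (f t) × halfIndex (f t) ≡ c)
    halfIndex-2-improper-at-branch c f f-inj at-x =
      three-into-two (toℕ ∘ proj₁ ∘ f) index-injective (λ t → by-half (proj₂ (at-x t)))
      where
      index-injective : Injective _≡_ _≡_ (toℕ ∘ proj₁ ∘ f)
      index-injective {t} {t'} eq = f-inj (trans (branch-edge (proj₁ (at-x t)))
        (trans (cong (λ i → i , end i) (Finₚ.toℕ-injective eq)) (sym (branch-edge (proj₁ (at-x t'))))))
      by-half : ∀ {n} → ⌊ n /2⌋ ≡ c → n ≡ c + c ⊎ n ≡ suc (c + c)
      by-half {n} refl = half-cases n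

    halfIndex-interval-at-branch : IntervalAt halfIndex x
    halfIndex-interval-at-branch _ (i , _) c _ _ _ c≤ = (i' , end i') , end-incident i' ,
      trans (cong ⌊_/2⌋ (Finₚ.toℕ-fromℕ< _)) (sym (n≡⌊n+n/2⌋ c))
      where
      c+c≤ : c + c ≤ toℕ i
      c+c≤ with half-cases (toℕ i)
      ... | inj₁ eq = ≤-trans (+-mono-≤ c≤ c≤) (≤-reflexive (sym eq))
      ... | inj₂ eq = ≤-trans (+-mono-≤ c≤ c≤) (≤-trans (n≤1+n _) (≤-reflexive (sym eq)))
      i' = fromℕ< (≤-<-trans c+c≤ (Finₚ.toℕ<n i))

  halfIndex-2-improper : IsImproper G 2 halfIndex
  halfIndex-2-improper u c = halfIndex-2-improper-at-branch u-branch c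
  halfIndex-2-improper v c = halfIndex-2-improper-at-branch v-branch c
  halfIndex-2-improper (inner i' k) c f f-inj at-x =
    three-into-two (toℕ ∘ proj₂ ∘ f) position-injective (proj₂ ∘ incident-inner ∘ proj₁ ∘ at-x)
    where
    position-injective : Injective _≡_ _≡_ (toℕ ∘ proj₂ ∘ f)
    position-injective {t} {t'} eq = f-inj (edge-≡ (trans (proj₁ (incident-inner (proj₁ (at-x t))))
      (sym (proj₁ (incident-inner (proj₁ (at-x t')))))) eq)

  halfIndex-interval : IsInterval G halfIndex
  halfIndex-interval u = halfIndex-interval-at-branch u-branch
  halfIndex-interval v = halfIndex-interval-at-branch v-branch
  halfIndex-interval (inner i' k) e₁ e₂ c inc₁ inc₂ ≤c c≤ =
    e₁ , inc₁ , ≤-antisym ≤c (≤-trans c≤ (≤-reflexive same))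
    where
    same : halfIndex e₂ ≡ halfIndex e₁
    same = cong (λ i → ⌊ toℕ i /2⌋) (trans (proj₁ (incident-inner inc₂)) (sym (proj₁ (incident-inner inc₁))))

  -- Proper interval colourings from zigzags

  zigzags⇒proper-interval : ∀ {s t} (a b : Fin m → ℕ) → (∀ i → Zigzag (ℓ i) (a i) (b i)) →
    Injective _≡_ _≡_ a → InRange s a → Injective _≡_ _≡_ b → InRange t b → HasImproperInterval G 1
  zigzags⇒proper-interval a b zigzag a-inj a-range b-inj b-range = α , shape⇒proper-interval (record
    { steps = λ i j j' j'≡ → subst (λ k → Consecutive (colour i k) _) (sym j'≡) (steps i (toℕ j))
    ; first-injective = injective-≗ at-first a-inj
    ; first-convex = injective-inRange⇒convex (injective-≗ at-first a-inj) (inRange-≗ at-first a-range)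
    ; last-injective = injective-≗ at-last b-inj
    ; last-convex = injective-inRange⇒convex (injective-≗ at-last b-inj) (inRange-≗ at-last b-range)
    })
    where
    open module Z i = Zigzag (zigzag i)
    α : E → ℕ
    α (i , j) = colour i (toℕ j)
    at-first : ∀ i → α (i , first i) ≡ a i
    at-first i = trans (cong (colour i) (toℕ-firstOf (ℓ i) (nonempty i))) (starts i)
    at-last : ∀ i → α (i , last i) ≡ b i
    at-last i = trans (cong (colour i ∘ pred) (suc-toℕ-lastOf (ℓ i) (nonempty i))) (ends i)

  evens : ℕ
  evens = zeros (parity ∘ ℓ)

  record Layout (a : Fin m → ℕ) : Set where
    field
      injective : Injective _≡_ _≡_ a
      bounded : ∀ i → a i < m
      even-below : ∀ i → parity (ℓ i) ≡ 0ℙ → a i < evens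
      odd-above : ∀ i → parity (ℓ i) ≡ 1ℙ → evens ≤ a i

  evens≤m : evens ≤ m
  evens≤m = subst (evens ≤_) (ones+zeros (parity ∘ ℓ)) (m≤n+m _ _)

  rank-layout : Layout (rank (parity ∘ ℓ))
  rank-layout = record
    { injective = rank-injective (parity ∘ ℓ)
    ; bounded = rank< (parity ∘ ℓ)
    ; even-below = rank<zeros (parity ∘ ℓ)
    ; odd-above = zeros≤rank (parity ∘ ℓ)
    }

  swapSuc-layout : ∀ {a r} → Layout a → evens ≤ r → suc r < m → Layout (swapSuc r ∘ a)
  swapSuc-layout {a} {r} layout evens≤r r<m = record
    { injective = λ eq → injective (trans (sym (swapSuc-involutive r _))
        (trans (cong (swapSuc r) eq) (swapSuc-involutive r _)))
    ; bounded = λ i → swapSuc-< r<m (bounded i)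
    ; even-below = λ i i-even → subst (_< evens)
        (sym (swapSuc-below (<-≤-trans (even-below i i-even) evens≤r))) (even-below i i-even)
    ; odd-above = λ i i-odd → swapSuc-≥ evens≤r (odd-above i i-odd)
    }
    where open Layout layout

  byClass : (ℕ → ℕ) → (ℕ → ℕ) → Parity → ℕ → ℕ
  byClass f g 0ℙ = f
  byClass f g 1ℙ = g

  module Ends {a} (layout : Layout a) (f g : ℕ → ℕ) where
    open Layout layout

    b : Fin m → ℕ
    b i = byClass f g (parity (ℓ i)) (a i)

    by-class : (P : Fin m → ℕ → Set) → (∀ i → parity (ℓ i) ≡ 0ℙ → P i (f (a i))) →
      (∀ i → parity (ℓ i) ≡ 1ℙ → P i (g (a i))) → ∀ i → P i (b i)
    by-class P even odd i with parity (ℓ i) in ℓ-parity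
    ... | 0ℙ = even i ℓ-parity
    ... | 1ℙ = odd i ℓ-parity

    b-injective : Injective _≡_ _≡_ f → Injective _≡_ _≡_ g → ∀ T →
      (∀ i → parity (ℓ i) ≡ 0ℙ → f (a i) < T) → (∀ i → parity (ℓ i) ≡ 1ℙ → T ≤ g (a i)) →
      Injective _≡_ _≡_ b
    b-injective f-inj g-inj T f< ≤g {i} {i'} eq with parity (ℓ i) in ℓi | parity (ℓ i') in ℓi'
    ... | 0ℙ | 0ℙ = injective (f-inj eq)
    ... | 1ℙ | 1ℙ = injective (g-inj eq)
    ... | 0ℙ | 1ℙ = contradiction (subst (_< T) eq (f< i ℓi)) (≤⇒≯ (≤g i' ℓi'))
    ... | 1ℙ | 0ℙ = contradiction (subst (_< T) (sym eq) (f< i' ℓi')) (≤⇒≯ (≤g i ℓi))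

  evens-even⇒proper-interval : ∀ {a} → Layout a → parity evens ≡ 0ℙ → HasImproperInterval G 1
  evens-even⇒proper-interval {a} layout evens-even = zigzags⇒proper-interval a b
    (by-class (λ i → Zigzag (ℓ i) (a i))
      (λ i i-even → zigzag-consecutive (nonempty i) i-even (flipParity-consecutive (a i)))
      (λ i i-odd → zigzag-stay i-odd))
    injective (λ i → z≤n , bounded i)
    (b-injective flipParity-injective (λ eq → eq) evens flip<evens odd-above)
    (by-class (λ _ c → 0 ≤ c × c < m) (λ i i-even → z≤n , <-≤-trans (flip<evens i i-even) evens≤m)
      (λ i _ → z≤n , bounded i))
    where
    open Layout layout
    open Ends layout flipParity (λ x → x)
    flip<evens : ∀ i → parity (ℓ i) ≡ 0ℙ → flipParity (a i) < evens
    flip<evens i i-even = flipParity-< evens-even (even-below i i-even)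

  evens-odd⇒proper-interval : ∀ {a} → Layout a → (∀ i → ℓ i ≡ 1 → parity (a i) ≡ 0ℙ) →
    parity evens ≡ 1ℙ → parity m ≡ 1ℙ → HasImproperInterval G 1
  evens-odd⇒proper-interval {a} layout units-even evens-odd m-odd = zigzags⇒proper-interval a b
    (by-class (λ i → Zigzag (ℓ i) (a i)) (λ i i-even → zigzag-up (nonempty i) i-even) odd-zigzag)
    injective (λ i → z≤n , bounded i)
    (b-injective suc-injective liftOdd-injective (suc evens) (λ i → s≤s ∘ even-below i) evens<lift)
    (by-class (λ _ c → 1 ≤ c × c < 1 + m) (λ i _ → s≤s z≤n , s≤s (bounded i))
      (λ i i-odd → ≤-trans (s≤s z≤n) (evens<lift i i-odd) , s≤s (liftOdd-≤ m-odd (bounded i))))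
    where
    open Layout layout
    open Ends layout suc liftOdd
    evens<lift : ∀ i → parity (ℓ i) ≡ 1ℙ → evens < liftOdd (a i)
    evens<lift i i-odd = liftOdd-> evens-odd (odd-above i i-odd)
    odd-zigzag : ∀ i → parity (ℓ i) ≡ 1ℙ → Zigzag (ℓ i) (a i) (liftOdd (a i))
    odd-zigzag i i-odd with 0ℙ-or-1ℙ (parity (a i))
    ... | inj₁ a-even = subst (Zigzag (ℓ i) (a i)) (sym (liftOdd-even _ a-even)) (zigzag-stay i-odd)
    ... | inj₂ a-odd = subst (Zigzag (ℓ i) (a i)) (sym (liftOdd-odd _ a-odd))
      (zigzag-up₂ i-odd λ ℓ≡1 → contradiction (trans (sym (units-even i ℓ≡1)) a-odd) λ ())

  -- A path of length 1 cannot climb by two, so evens-odd⇒proper-interval needs it at an even colour;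
  -- if it is not, exchange its colour with the next one, which belongs to another odd path.
  even-unit-layout : (∀ i j → ℓ i ≡ 1 → ℓ j ≡ 1 → i ≡ j) → parity m ≡ 1ℙ →
    ∃[ a ] Layout a × (∀ i → ℓ i ≡ 1 → parity (a i) ≡ 0ℙ)
  even-unit-layout unique m-odd with Finₚ.any? (λ i → ℓ i ≟ 1)
  ... | no none = rank (parity ∘ ℓ) , rank-layout , λ i ℓ≡1 → contradiction (i , ℓ≡1) none
  ... | yes (i₁ , ℓi₁≡1) = at-rank (0ℙ-or-1ℙ (parity (rank (parity ∘ ℓ) i₁)))
    where
    open Layout rank-layout
    r = rank (parity ∘ ℓ) i₁
    even-at : ∀ a → parity (a i₁) ≡ 0ℙ → ∀ i → ℓ i ≡ 1 → parity (a i) ≡ 0ℙ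
    even-at a ai₁-even i ℓ≡1 = subst (λ i → parity (a i) ≡ 0ℙ) (unique i₁ i ℓi₁≡1 ℓ≡1) ai₁-even
    suc-r-even : parity r ≡ 1ℙ → parity (suc r) ≡ 0ℙ
    suc-r-even r-odd = trans (parity-suc r) (cong _⁻¹ r-odd)
    suc-r<m : parity r ≡ 1ℙ → suc r < m
    suc-r<m r-odd = ≤∧≢⇒< (bounded i₁) λ suc-r≡m →
      contradiction (trans (sym (suc-r-even r-odd)) (trans (cong parity suc-r≡m) m-odd)) λ ()
    at-rank : parity r ≡ 0ℙ ⊎ parity r ≡ 1ℙ → ∃[ a ] Layout a × (∀ i → ℓ i ≡ 1 → parity (a i) ≡ 0ℙ)
    at-rank (inj₁ r-even) = rank (parity ∘ ℓ) , rank-layout , even-at (rank (parity ∘ ℓ)) r-even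
    at-rank (inj₂ r-odd) = swapSuc r ∘ rank (parity ∘ ℓ) ,
      swapSuc-layout rank-layout (odd-above i₁ (cong parity ℓi₁≡1)) (suc-r<m r-odd) ,
      even-at (swapSuc r ∘ rank (parity ∘ ℓ)) (trans (cong parity (swapSuc-at r)) (suc-r-even r-odd))

  -- Counting edges and Eulerian circuits

  edges↔ : E ↔ Fin (sum ℓ)
  edges↔ = Σ-Fin↔Fin-sum ℓ

  oddEdges⇒odd : OddEdges G → parity (sum ℓ) ≡ 1ℙ
  oddEdges⇒odd (n , E↔n , k , n≡) =
    trans (cong parity (Perm.↔⇒≡ (↔-trans (↔-sym edges↔) E↔n))) (trans (cong parity n≡) (parity-odd k))

  odd⇒oddEdges : parity (sum ℓ) ≡ 1ℙ → OddEdges G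
  odd⇒oddEdges N-odd = sum ℓ , edges↔ , odd-witness (sum ℓ) N-odd

  open Trails G

  path : ∀ i → Trail (λ (j : Fin (ℓ i)) → (i , j)) u v
  path i = record
    { length = ℓ i ; vertex = at i ; edge = ↔-refl
    ; starts = refl ; ends = at-ℓ i ; joins = λ _ → inj₁ (refl , refl) }

  even⇒eulerian : parity m ≡ 0ℙ → Eulerian G
  even⇒eulerian m-even = length , vertex ∘ toℕ , Inverse.to edge , closed , Bijection.bijective (↔⇒⤖ edge) ,
    λ k → Joins-resp (cong vertex (sym (Finₚ.toℕ-inject₁ k))) refl (joins k)
    where
    open Trail (circuit m m-even path)
    closed : vertex 0 ≡ vertex (toℕ (Fin.fromℕ length))
    closed = trans starts (sym (trans (cong vertex (Finₚ.toℕ-fromℕ length)) ends))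

  isU : V → ℕ
  isU u = 1
  isU v = 0
  isU (inner _ _) = 0

  isU-≢ : ∀ {x} → x ≢ u → isU x ≡ 0
  isU-≢ {u} x≢u = contradiction refl x≢u
  isU-≢ {v} _ = refl
  isU-≢ {inner _ _} _ = refl

  uEnds : E → ℕ
  uEnds e = isU (Graph.end₁ G e) + isU (Graph.end₂ G e)

  uEnds-joins : ∀ {e x y} → Joins G e x y → uEnds e ≡ isU x + isU y
  uEnds-joins (inj₁ (refl , refl)) = refl
  uEnds-joins {e} (inj₂ (refl , refl)) = +-comm (isU (Graph.end₁ G e)) _

  sum-uEnds : sum (uEnds ∘ Inverse.from edges↔) ≡ m
  sum-uEnds = trans (sum-Σ-Fin ℓ uEnds) (trans (sum-cong-≗ on-path) (sum-ones m))
    where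
    on-path : ∀ i → sum (λ j → uEnds (i , j)) ≡ 1
    on-path i = sum-at-zero (ℓ i) (nonempty i) _
      (λ j j≡0 → cong₂ _+_ (cong (isU ∘ at i) j≡0) (isU-≢ (1+n≢0 ∘ at≡u i _)))
      (λ j j≢0 → cong₂ _+_ (isU-≢ (j≢0 ∘ at≡u i _)) (isU-≢ (1+n≢0 ∘ at≡u i _)))

  -- Each visit of a closed trail to u uses two edges at u, and exactly m edges have an endpoint u.
  eulerian⇒even : Eulerian G → parity m ≡ 0ℙ
  eulerian⇒even (n , w , t , closed , t-bijective , joins) =
    subst (λ k → parity k ≡ 0ℙ) X+X≡m (parity-double X)
    where
    g : Fin (suc n) → ℕ
    g = isU ∘ w
    X = sum (g ∘ Fin.inject₁)
    shifted : sum (g ∘ Fin.suc) ≡ X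
    shifted = +-cancelˡ-≡ (g Fin.zero) _ _
      (trans (sum-init-last g) (trans (cong (X +_) (cong isU (sym closed))) (+-comm X _)))
    t↔ : Fin n ↔ E
    t↔ = ⤖⇒↔ (mk⤖ t-bijective)
    X+X≡m : X + X ≡ m
    X+X≡m = begin
      X + X                                         ≡⟨ cong (X +_) shifted ⟨
      X + sum (g ∘ Fin.suc)                         ≡⟨ ∑-distrib-+ (g ∘ Fin.inject₁) (g ∘ Fin.suc) ⟨
      sum (λ k → g (Fin.inject₁ k) + g (Fin.suc k)) ≡⟨ sum-cong-≗ (λ k → sym (uEnds-joins (joins k))) ⟩
      sum (uEnds ∘ t)                               ≡⟨ ∑-permute (uEnds ∘ t) (↔-trans (↔-sym edges↔) (↔-sym t↔)) ⟩
      sum (uEnds ∘ t ∘ Inverse.from t↔ ∘ from)      ≡⟨ sum-cong-≗ (cong uEnds ∘ Inverse.strictlyInverseˡ t↔ ∘ from) ⟩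
      sum (uEnds ∘ from)                            ≡⟨ sum-uEnds ⟩
      m                                             ∎
      where
      open ≡-Reasoning
      from = Inverse.from edges↔

  no-0-improper : Fin m → ¬ HasImproperInterval G 0
  no-0-improper i (α , improper , _) =
    improper u _ (λ _ → i , first i) (λ { {0F} {0F} _ → refl })
      (λ _ → BranchVertex.end-incident u-branch i , refl)

  no-proper-interval : Eulerian G × OddEdges G → ¬ HasImproperInterval G 1
  no-proper-interval (eulerian , odd) (α , improper , interval) = contradiction (trans (sym (oddEdges⇒odd odd))
    (proper-interval⇒even-edges improper interval (eulerian⇒even eulerian))) λ ()

  odd-evens⇒odd-edges : parity evens ≡ 1ℙ → parity m ≡ 0ℙ → parity (sum ℓ) ≡ 1ℙ
  odd-evens⇒odd-edges evens-odd m-even = ℙₚ.+-cancelʳ-≡ 1ℙ _ _ (begin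
    parity (sum ℓ) ℙ.+ 1ℙ          ≡⟨ cong₂ ℙ._+_ odds≡ (sym evens-odd) ⟩
    parity odds ℙ.+ parity evens   ≡⟨ +-homo-+ odds evens ⟨
    parity (odds + evens)          ≡⟨ cong parity (ones+zeros (parity ∘ ℓ)) ⟩
    parity m                       ≡⟨ m-even ⟩
    1ℙ ℙ.+ 1ℙ                      ∎)
    where
    open ≡-Reasoning
    odds = ones (parity ∘ ℓ)
    odds≡ = parity-sum-cong ℓ (bit ∘ parity ∘ ℓ) (sym ∘ parity-bit ∘ parity ∘ ℓ)

  proper-interval-colouring : (∀ i j → ℓ i ≡ 1 → ℓ j ≡ 1 → i ≡ j) → ¬ (Eulerian G × OddEdges G) →
    HasImproperInterval G 1
  proper-interval-colouring unique unobstructed with 0ℙ-or-1ℙ (parity evens) | 0ℙ-or-1ℙ (parity m)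
  ... | inj₁ evens-even | _ = evens-even⇒proper-interval rank-layout evens-even
  ... | inj₂ evens-odd | inj₂ m-odd with even-unit-layout unique m-odd
  ...   | _ , layout , units-even = evens-odd⇒proper-interval layout units-even evens-odd m-odd
  proper-interval-colouring unique unobstructed | inj₂ evens-odd | inj₁ m-even =
    contradiction (even⇒eulerian m-even , odd⇒oddEdges (odd-evens⇒odd-edges evens-odd m-even)) unobstructed

proposition9 : (m : ℕ) → 2 ≤ m → (ℓ : Fin m → ℕ) →
    (∀ i → 1 ≤ ℓ i) → (∀ i j → ℓ i ≡ 1 → ℓ j ≡ 1 → i ≡ j) →
    ((Eulerian (θ m ℓ) × OddEdges (θ m ℓ)) → MuIntEq (θ m ℓ) 2) ×
    (¬ (Eulerian (θ m ℓ) × OddEdges (θ m ℓ)) → MuIntEq (θ m ℓ) 1)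
proposition9 m@(suc _) _ ℓ nonempty unique =
  (λ obstructed → (halfIndex , halfIndex-2-improper , halfIndex-interval) , λ
    { zero _ → no-0-improper 0F
    ; (suc zero) _ → no-proper-interval obstructed
    ; (suc (suc _)) (s≤s (s≤s ())) })
  , (λ unobstructed → proper-interval-colouring unique unobstructed , λ
    { zero _ → no-0-improper 0F
    ; (suc _) (s≤s ()) })
  where open Theta m ℓ nonempty
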